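{- If $A\subseteq 2^\omega$ has the Baire property, then $A$ is Mathias-Silver measurable, i.e., there exists a Mathias-Silver tree $p$ such that $[p]\subseteq A$ or $[p]\cap A=\emptyset$.
   Context: A tree is a set $T\subseteq 2^{<\omega}$ closed under initial segments. A node $t\in T$ is splitting if $t^\frown 0, t^\frown 1\in T$. $T$ is perfect if every node has a splitting extension in $T$. $[p]=\{x\in 2^\omega:\forall n\,(x\restriction n\in p)\}$. A Silver tree is a perfect tree $p\subseteq 2^{<\omega}$ such that for all $s,t\in p$ with $|s|=|t|$ and $i\in\{0,1\}$, $s^\frown i\in p\iff t^\frown i\in p$. For a Silver tree $p$: if $t$ is a splitting node of $p$, $|t|+1$ is called a splitting level; $S(p)$ is the set of splitting levels; $U(p):=\{n\in\omega:\forall x\in[p]\,(x(n)=1)\}$; and $\{n^p_k:k\ge 1\}$ is the increasing enumeration of $S(p)\cup U(p)$. A Silver tree $p$ is a Mathias-Silver tree if there are infinitely many triples $(n^p_{m_j},n^p_{m_j+1},n^p_{m_j+2})$ ($j\ge1$) such that: (1) each $m_j$ is even; (2) $n^p_{m_j},n^p_{m_j+1},n^p_{m_j+2}\in S(p)$ with $n^p_{m_j}+1<n^p_{m_j+1}$ and $n^p_{m_j+1}+1<n^p_{m_j+2}$; (3) for all $t\in p$ and $i<|t|$, if $n^p_{m_j}<i<n^p_{m_j+1}$ or $n^p_{m_j+1}<i<n^p_{m_j+2}$, then $t(i)=0$. The Baire property refers to the usual topology on $2^\omega$. -}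

module Defs where

open import Level using (0ℓ)
open import Data.Bool using (Bool; true; false)
open import Data.Nat using (ℕ; zero; suc; _+_; _∸_; _≤_; _<_)
open import Data.Nat.Divisibility using (_∣_)
open import Data.Fin using (Fin; toℕ)
open import Data.List using (List; []; _∷_; _++_; [_]; length; lookup)
open import Data.Product using (Σ; ∃; ∃-syntax; _×_; _,_)
open import Data.Sum using (_⊎_)
open import Relation.Nullary using (¬_)
open import Relation.Binary.PropositionalEquality using (_≡_)

-- Cantor space 2^ω, finite binary strings 2^{<ω} (false = 0, true = 1).
-- Coordinates are 0-indexed: x ↾ n = (x 0, …, x (n-1)).

Cantor : Set
Cantor = ℕ → Bool

_↾_ : Cantor → ℕ → List Bool
x ↾ zero  = []
x ↾ suc n = x 0 ∷ ((λ k → x (suc k)) ↾ n)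

InCyl : List Bool → Cantor → Set
InCyl s x = x ↾ length s ≡ s

IsOpen : (Cantor → Set) → Set
IsOpen U = ∀ x → U x → ∃[ n ] (∀ y → y ↾ n ≡ x ↾ n → U y)

NowhereDense : (Cantor → Set) → Set
NowhereDense N = ∀ s → ∃[ t ] (∀ y → InCyl (s ++ t) y → ¬ N y)

Meager : (Cantor → Set) → Set₁
Meager M = Σ (ℕ → Cantor → Set) λ N → ((∀ (k : ℕ) → NowhereDense (N k)) × (∀ x → M x → ∃[ k ] N k x))

SymDiff : (Cantor → Set) → (Cantor → Set) → Cantor → Set
SymDiff A U x = (A x × ¬ U x) ⊎ (U x × ¬ A x)

BaireProperty : (Cantor → Set) → Set₁
BaireProperty A = Σ (Cantor → Set) λ U → (IsOpen U × Meager (SymDiff A U))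

Tree : Set₁
Tree = List Bool → Set

IsTree : Tree → Set
IsTree p = ∀ s t → p (s ++ t) → p s

Splitting : Tree → List Bool → Set
Splitting p t = p (t ++ [ false ]) × p (t ++ [ true ])

Perfect : Tree → Set
Perfect p = p [] × IsTree p × (∀ t → p t → ∃[ u ] Splitting p (t ++ u))

Silver : Tree → Set
Silver p = Perfect p ×
  (∀ s t → length s ≡ length t → p s → p t → ∀ (i : Bool) →
     (p (s ++ [ i ]) → p (t ++ [ i ])) × (p (t ++ [ i ]) → p (s ++ [ i ])))

Body : Tree → Cantor → Set
Body p x = ∀ n → p (x ↾ n)

-- S(p): coordinates at which splitting occurs (0-indexed)
SLevel : Tree → ℕ → Set
SLevel p n = ∃[ t ] (p t × Splitting p t × length t ≡ n)

ULevel : Tree → ℕ → Set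
ULevel p n = ∀ x → Body p x → x n ≡ true

IsIncEnum : (ℕ → Set) → (ℕ → ℕ) → Set
IsIncEnum P e = (∀ k → e k < e (suc k)) × (∀ k → P (e k)) × (∀ n → P n → ∃[ k ] e k ≡ n)

-- a good triple (n_m, n_{m+1}, n_{m+2}) for the 1-indexed enumeration nn
GoodTriple : Tree → (ℕ → ℕ) → ℕ → Set
GoodTriple p nn m =
  2 ∣ m × 1 ≤ m ×
  SLevel p (nn m) × SLevel p (nn (suc m)) × SLevel p (nn (suc (suc m))) ×
  suc (nn m) < nn (suc m) × suc (nn (suc m)) < nn (suc (suc m)) ×
  (∀ t → p t → ∀ (i : Fin (length t)) →
     ((nn m < toℕ i × toℕ i < nn (suc m)) ⊎ (nn (suc m) < toℕ i × toℕ i < nn (suc (suc m)))) →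
     lookup t i ≡ false)

MathiasSilver : Tree → Set
MathiasSilver p = Silver p ×
  ∃[ e ] (IsIncEnum (λ n → SLevel p n ⊎ ULevel p n) e ×
          (∀ k → ∃[ m ] (k ≤ m × GoodTriple p (λ j → e (j ∸ 1)) m)))

module Submission where

-- Write A △ U ⊆ ⋃ₖ Nₖ with U open and every Nₖ nowhere dense. The heart of the proof
-- is a fusion lemma (`fusion`): inside any basic open set [s] there is a Mathias–Silver
-- tree whose body avoids every Nₖ. If U is nonempty it contains some [s] and the tree
-- found there lies inside A; if U is empty the tree found in 2^ω is disjoint from A.
--
-- The trees are presented by patterns: every coordinate is free or fixed to a bit, and
-- the tree consists of the strings agreeing with the pattern (`PatternTree`); such a tree
-- is Silver, its splitting levels are the free coordinates, and coordinates fixed to 1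
-- are constant. A gadget ⋆0⋆0⋆0⋆ in the pattern yields a good triple (`GadgetPattern`),
-- so patterns with gadgets arbitrarily far out give Mathias–Silver trees. The fusion
-- pattern is built in stages: stage k + 1 fixes a diagonal block forcing every branch
-- into a basic open set missing Nₖ (`diagonalBlock`), followed by a gadget (`Fusion`).

open import Defs
open import Level using (0ℓ)
open import Axiom.ExcludedMiddle using (ExcludedMiddle)
open import Data.Bool using (Bool; true; false; T)
open import Data.Empty using (⊥; ⊥-elim)
open import Data.Fin using (Fin; toℕ) renaming (zero to fzero; suc to fsuc)
open import Data.List using (List; []; _∷_; _++_; [_]; length; lookup; map)
open import Data.List.Properties using (++-assoc; ++-identityʳ; length-++; length-map; ∷-injectiveˡ; ∷-injectiveʳ)
open import Data.Nat using (ℕ; zero; suc; _+_; _∸_; _≤_; _<_; _<ᵇ_; z≤n; s≤s; _≤?_; _<?_)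
open import Data.Nat.Divisibility using (_∣_; divides)
open import Data.Nat.Properties
open import Data.Product using (Σ; _×_; _,_; proj₁; proj₂; ∃-syntax)
open import Data.Sum using (_⊎_; inj₁; inj₂)
open import Data.Unit using (⊤; tt)
open import Function using (id)
open import Relation.Binary.Definitions using (tri<; tri≈; tri>)
open import Relation.Binary.PropositionalEquality hiding ([_])
open import Relation.Nullary using (¬_; yes; no)

shift : {A : Set} → ℕ → (ℕ → A) → ℕ → A
shift m x n = x (m + n)

entry : {A : Set} → A → List A → ℕ → A
entry d []       _       = d
entry d (a ∷ as) zero    = a
entry d (a ∷ as) (suc j) = entry d as j

entry-++ʳ : {A : Set} (d : A) (u v : List A) (j : ℕ) → entry d (u ++ v) (length u + j) ≡ entry d v j
entry-++ʳ d []      v j = refl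
entry-++ʳ d (a ∷ u) v j = entry-++ʳ d u v j

entry-++ˡ : {A : Set} (d : A) (u v : List A) (i : ℕ) → i < length u → entry d (u ++ v) i ≡ entry d u i
entry-++ˡ d (a ∷ u) v zero    _         = refl
entry-++ˡ d (a ∷ u) v (suc i) (s≤s i<u) = entry-++ˡ d u v i i<u

entry-map : {A B : Set} (g : A → B) (d : A) (d′ : B) (u : List A) (j : ℕ) →
            j < length u → entry d′ (map g u) j ≡ g (entry d u j)
entry-map g d d′ (a ∷ u) zero    _         = refl
entry-map g d d′ (a ∷ u) (suc j) (s≤s j<u) = entry-map g d d′ u j j<u

↾-length : ∀ x n → length (x ↾ n) ≡ n
↾-length x zero    = refl
↾-length x (suc n) = cong suc (↾-length (shift 1 x) n)

↾-+ : ∀ x a b → x ↾ (a + b) ≡ (x ↾ a) ++ (shift a x ↾ b)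
↾-+ x zero    b = refl
↾-+ x (suc a) b = cong (x 0 ∷_) (↾-+ (shift 1 x) a b)

↾-prefix : ∀ x n u v → x ↾ n ≡ u ++ v → x ↾ length u ≡ u
↾-prefix x n       []      v eq = refl
↾-prefix x zero    (b ∷ u) v ()
↾-prefix x (suc n) (b ∷ u) v eq =
  cong₂ _∷_ (∷-injectiveˡ eq) (↾-prefix (shift 1 x) n u v (∷-injectiveʳ eq))

↾-entrywise : ∀ τ x → (∀ j → j < length τ → entry false τ j ≡ x j) → x ↾ length τ ≡ τ
↾-entrywise []      x agree = refl
↾-entrywise (b ∷ τ) x agree =
  cong₂ _∷_ (sym (agree 0 (s≤s z≤n))) (↾-entrywise τ (shift 1 x) (λ j j<τ → agree (suc j) (s≤s j<τ)))

data Code : Set where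
  free  : Code
  fixed : Bool → Code

Match : Code → Bool → Set
Match free      b = ⊤
Match (fixed c) b = c ≡ b

leftmost : Code → Bool
leftmost free      = false
leftmost (fixed b) = b

leftmost-matches : ∀ c → Match c (leftmost c)
leftmost-matches free      = tt
leftmost-matches (fixed b) = refl

-- the coordinates of a pattern that are splitting levels or constantly 1
mayBeOne : Code → Bool
mayBeOne free      = true
mayBeOne (fixed b) = b

fixed-match : ∀ {c b y} → c ≡ fixed b → Match c y → b ≡ y
fixed-match refl m = m

free-matches : ∀ {c} b → c ≡ free → Match c b
free-matches b refl = tt

matches-both→free : ∀ c → Match c false → Match c true → c ≡ free
matches-both→free free      _    _  = refl
matches-both→free (fixed b) refl ()

Fits : (ℕ → Code) → List Bool → Set
Fits g []      = ⊤
Fits g (b ∷ t) = Match (g 0) b × Fits (shift 1 g) t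

fits-++ : ∀ g s t → Fits g (s ++ t) → Fits g s × Fits (shift (length s) g) t
fits-++ g []      t h        = tt , h
fits-++ g (b ∷ s) t (m , h) = let (hs , ht) = fits-++ (shift 1 g) s t h in (m , hs) , ht

fits-++⁺ : ∀ g s t → Fits g s → Fits (shift (length s) g) t → Fits g (s ++ t)
fits-++⁺ g []      t _        ht = ht
fits-++⁺ g (b ∷ s) t (m , hs) ht = m , fits-++⁺ (shift 1 g) s t hs ht

fits-snoc : ∀ g s b → Fits g (s ++ [ b ]) → Match (g (length s)) b
fits-snoc g []      b (m , _) = m
fits-snoc g (c ∷ s) b (_ , h) = fits-snoc (shift 1 g) s b h

fits-snoc⁺ : ∀ g s b → Fits g s → Match (g (length s)) b → Fits g (s ++ [ b ])
fits-snoc⁺ g []      b _        m = m , tt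
fits-snoc⁺ g (c ∷ s) b (m₀ , h) m = m₀ , fits-snoc⁺ (shift 1 g) s b h m

fits-lookup : ∀ g t → Fits g t → (i : Fin (length t)) → Match (g (toℕ i)) (lookup t i)
fits-lookup g (b ∷ t) (m , h) fzero    = m
fits-lookup g (b ∷ t) (m , h) (fsuc i) = fits-lookup (shift 1 g) t h i

matching→prefixes : ∀ g x → (∀ i → Match (g i) (x i)) → ∀ n → Fits g (x ↾ n)
matching→prefixes g x h zero    = tt
matching→prefixes g x h (suc n) = h 0 , matching→prefixes (shift 1 g) (shift 1 x) (λ i → h (suc i)) n

prefixes→matching : ∀ g x → (∀ n → Fits g (x ↾ n)) → ∀ i → Match (g i) (x i)
prefixes→matching g x h i = at g x i (h (suc i))
  where
  at : ∀ g x i → Fits g (x ↾ suc i) → Match (g i) (x i)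
  at g x zero    (m , _) = m
  at g x (suc i) (_ , h) = at (shift 1 g) (shift 1 x) i h

module PatternTree (f : ℕ → Code) where

  tree : Tree
  tree = Fits f

  leftBranch : Cantor
  leftBranch i = leftmost (f i)

  leftBranch-prefixes : ∀ n → tree (leftBranch ↾ n)
  leftBranch-prefixes = matching→prefixes f leftBranch (λ i → leftmost-matches (f i))

  -- every free coordinate n is a splitting level: split the leftmost branch there
  free→splitting : ∀ n → f n ≡ free → SLevel tree n
  free→splitting n fn≡free =
    t , leftBranch-prefixes n ,
    (fits-snoc⁺ f t false (leftBranch-prefixes n) (free-matches false ft≡free) ,
     fits-snoc⁺ f t true  (leftBranch-prefixes n) (free-matches true  ft≡free)) ,
    ↾-length leftBranch n
    where
    t = leftBranch ↾ n
    ft≡free : f (length t) ≡ free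
    ft≡free = trans (cong f (↾-length leftBranch n)) fn≡free

  splitting→free : ∀ n → SLevel tree n → f n ≡ free
  splitting→free n (t , _ , (t0 , t1) , refl) =
    matches-both→free (f (length t)) (fits-snoc f t false t0) (fits-snoc f t true t1)

  fixedOne→constant : ∀ n → f n ≡ fixed true → ULevel tree n
  fixedOne→constant n fn≡1 x x∈p = sym (fixed-match fn≡1 (prefixes→matching f x x∈p n))

  SU : ℕ → Set
  SU n = SLevel tree n ⊎ ULevel tree n

  mayBeOne→SU : ∀ n → mayBeOne (f n) ≡ true → SU n
  mayBeOne→SU n h with f n in eq
  ... | free       = inj₁ (free→splitting n eq)
  ... | fixed true = inj₂ (fixedOne→constant n eq)

  -- a constant coordinate is 1 on the leftmost branch, so it is free or fixed to 1
  SU→mayBeOne : ∀ n → SU n → mayBeOne (f n) ≡ true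
  SU→mayBeOne n (inj₁ split) = cong mayBeOne (splitting→free n split)
  SU→mayBeOne n (inj₂ const) = onLeft (f n) (const leftBranch leftBranch-prefixes)
    where
    onLeft : ∀ c → leftmost c ≡ true → mayBeOne c ≡ true
    onLeft (fixed b) h = h

  -- with unboundedly many free coordinates the tree is Silver: membership of s ⌢ i
  -- depends only on the length of s
  silver : (∀ n → ∃[ a ] (n ≤ a × f a ≡ free)) → Silver tree
  silver unbounded = (tt , isTree , splitsAbove) , uniform
    where
    isTree : IsTree tree
    isTree s t st∈p = proj₁ (fits-++ f s t st∈p)

    splitsAbove : ∀ t → tree t → ∃[ u ] Splitting tree (t ++ u)
    splitsAbove t t∈p = u , fits-snoc⁺ f (t ++ u) false tu∈p (free-matches false ftu≡free)
                          , fits-snoc⁺ f (t ++ u) true  tu∈p (free-matches true  ftu≡free)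
      where
      L = length t
      a = proj₁ (unbounded L)
      u = shift L leftBranch ↾ (a ∸ L)
      tu∈p : tree (t ++ u)
      tu∈p = fits-++⁺ f t u t∈p
               (matching→prefixes (shift L f) (shift L leftBranch) (λ i → leftmost-matches (f (L + i))) (a ∸ L))
      |tu|≡a : length (t ++ u) ≡ a
      |tu|≡a = trans (length-++ t)
                 (trans (cong (L +_) (↾-length (shift L leftBranch) (a ∸ L))) (m+[n∸m]≡n (proj₁ (proj₂ (unbounded L)))))
      ftu≡free : f (length (t ++ u)) ≡ free
      ftu≡free = trans (cong f |tu|≡a) (proj₂ (proj₂ (unbounded L)))

    uniform : ∀ s t → length s ≡ length t → tree s → tree t → ∀ i →
              (tree (s ++ [ i ]) → tree (t ++ [ i ])) × (tree (t ++ [ i ]) → tree (s ++ [ i ]))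
    uniform s t |s|≡|t| s∈p t∈p i =
      (λ si∈p → fits-snoc⁺ f t i t∈p (subst (λ n → Match (f n) i) |s|≡|t| (fits-snoc f s i si∈p))) ,
      (λ ti∈p → fits-snoc⁺ f s i s∈p (subst (λ n → Match (f n) i) (sym |s|≡|t|) (fits-snoc f t i ti∈p)))

true≢false : ∀ {b} → b ≡ true → b ≡ false → ⊥
true≢false refl ()

module Enumeration (g : ℕ → Bool) (unbounded : ∀ n → ∃[ m ] (n < m × g m ≡ true)) where

  LeastFrom : ℕ → ℕ → Set
  LeastFrom n r = n ≤ r × g r ≡ true × (∀ m → n ≤ m → m < r → g m ≡ false)

  least-unique : ∀ {n r r′} → LeastFrom n r → LeastFrom n r′ → r ≡ r′
  least-unique {n} {r} {r′} (n≤r , gr , below-r) (n≤r′ , gr′ , below-r′) with <-cmp r r′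
  ... | tri< r<r′ _ _ = ⊥-elim (true≢false gr (below-r′ r n≤r r<r′))
  ... | tri≈ _ r≡r′ _ = r≡r′
  ... | tri> _ _ r′<r = ⊥-elim (true≢false gr′ (below-r r′ n≤r′ r′<r))

  search : ℕ → ℕ → ℕ
  search n zero = n
  search n (suc fuel) with g n
  ... | true  = n
  ... | false = search (suc n) fuel

  search-least : ∀ n fuel k → k < fuel → g (k + n) ≡ true → LeastFrom n (search n fuel)
  search-least n (suc fuel) k k<fuel gkn with g n in gn
  ... | true = ≤-refl , gn , λ m n≤m m<n → ⊥-elim (<-irrefl refl (≤-trans m<n n≤m))
  search-least n (suc fuel) zero    _              gkn | false = ⊥-elim (true≢false gkn gn)
  search-least n (suc fuel) (suc k) (s≤s k<fuel) gkn | false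
    with search-least (suc n) fuel k k<fuel (trans (cong g (+-suc k n)) gkn)
  ... | n<r , gr , below-r = <⇒≤ n<r , gr , below
    where
    below : ∀ m → n ≤ m → m < search (suc n) fuel → g m ≡ false
    below m n≤m m<r with m≤n⇒m<n∨m≡n n≤m
    ... | inj₁ n<m  = below-r m n<m m<r
    ... | inj₂ refl = gn

  -- the least element ≥ n, searched with enough fuel to reach a known element
  least : ℕ → ℕ
  least n = search n (suc (proj₁ (unbounded n) ∸ n))

  least-spec : ∀ n → LeastFrom n (least n)
  least-spec n = search-least n (suc (m ∸ n)) (m ∸ n) ≤-refl (trans (cong g (m∸n+n≡m (<⇒≤ n<m))) gm)
    where
    m = proj₁ (unbounded n)
    n<m = proj₁ (proj₂ (unbounded n))
    gm = proj₂ (proj₂ (unbounded n))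

  e : ℕ → ℕ
  e zero    = least 0
  e (suc k) = least (suc (e k))

  e-inc : ∀ k → e k < e (suc k)
  e-inc k = proj₁ (least-spec (suc (e k)))

  e-true : ∀ k → g (e k) ≡ true
  e-true zero    = proj₁ (proj₂ (least-spec 0))
  e-true (suc k) = proj₁ (proj₂ (least-spec (suc (e k))))

  e-mono : ∀ {k l} → k ≤ l → e k ≤ e l
  e-mono {k} {zero}  z≤n  = ≤-refl
  e-mono {k} {suc l} k≤l′ with m≤n⇒m<n∨m≡n k≤l′
  ... | inj₁ (s≤s k≤l) = ≤-trans (e-mono k≤l) (<⇒≤ (e-inc l))
  ... | inj₂ refl      = ≤-refl

  e-reflects-< : ∀ k l → e k < e l → k < l
  e-reflects-< k l ek<el with k <? l
  ... | yes k<l = k<l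
  ... | no  k≮l = ⊥-elim (<-irrefl refl (≤-trans ek<el (e-mono (≮⇒≥ k≮l))))

  e-grows : ∀ k → k ≤ e k
  e-grows zero    = z≤n
  e-grows (suc k) = ≤-trans (s≤s (e-grows k)) (e-inc k)

  -- every element n ≤ e j is enumerated: nothing is skipped below e 0 or between
  -- consecutive values
  e-covers : ∀ j n → g n ≡ true → n ≤ e j → ∃[ k ] e k ≡ n
  e-covers zero n gn n≤e0 with m≤n⇒m<n∨m≡n n≤e0
  ... | inj₁ n<e0 = ⊥-elim (true≢false gn (proj₂ (proj₂ (least-spec 0)) n z≤n n<e0))
  ... | inj₂ n≡e0 = 0 , sym n≡e0
  e-covers (suc j) n gn n≤ej′ with m≤n⇒m<n∨m≡n n≤ej′
  ... | inj₂ n≡ej′ = suc j , sym n≡ej′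
  ... | inj₁ n<ej′ with n ≤? e j
  ...   | yes n≤ej = e-covers j n gn n≤ej
  ...   | no  n≰ej = ⊥-elim (true≢false gn (proj₂ (proj₂ (least-spec (suc (e j)))) n (≰⇒> n≰ej) n<ej′))

  e-surjective : ∀ n → g n ≡ true → ∃[ k ] e k ≡ n
  e-surjective n gn = e-covers n n gn (e-grows n)

  e-next : ∀ b c → e b ≡ c → g (1 + c) ≡ false → g (2 + c) ≡ true → e (suc b) ≡ 2 + c
  e-next b c refl g1 g2 = least-unique (least-spec (suc c)) (n≤1+n (suc c) , g2 , below)
    where
    below : ∀ m → suc c ≤ m → m < 2 + c → g m ≡ false
    below m c<m m<2+c rewrite ≤-antisym (≤-pred m<2+c) c<m = g1

even-or-next-even : ∀ n → 2 ∣ n ⊎ 2 ∣ suc n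
even-or-next-even zero    = inj₁ (divides 0 refl)
even-or-next-even (suc n) with even-or-next-even n
... | inj₁ (divides q n≡2q) = inj₂ (divides (suc q) (cong (λ m → suc (suc m)) n≡2q))
... | inj₂ 2∣1+n            = inj₁ 2∣1+n

record Window (f : ℕ → Code) (c : ℕ) : Set where
  field
    free₀ : f c ≡ free
    zero₁ : f (1 + c) ≡ fixed false
    free₂ : f (2 + c) ≡ free
    zero₃ : f (3 + c) ≡ fixed false
    free₄ : f (4 + c) ≡ free

GadgetAt : (ℕ → Code) → ℕ → Set
GadgetAt f a = Window f a × Window f (2 + a)

-- A pattern with gadgets arbitrarily far out gives a Mathias–Silver tree: the free
-- coordinates of a window are consecutive in S(p) ∪ U(p), and of the windows at a
-- and a + 2 one starts at an even index of the enumeration.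
module GadgetPattern (f : ℕ → Code) (gadgets : ∀ n → ∃[ a ] (n ≤ a × GadgetAt f a)) where
  open PatternTree f
  open Window

  freeAbove : ∀ n → ∃[ a ] (n ≤ a × f a ≡ free)
  freeAbove n = let (a , n≤a , W , _) = gadgets n in a , n≤a , free₀ W

  mayBeOneAbove : ∀ n → ∃[ a ] (n < a × mayBeOne (f a) ≡ true)
  mayBeOneAbove n = let (a , n<a , fa≡free) = freeAbove (suc n) in a , n<a , cong mayBeOne fa≡free

  open Enumeration (λ n → mayBeOne (f n)) mayBeOneAbove

  -- the 1-indexed enumeration of S(p) ∪ U(p)
  nn : ℕ → ℕ
  nn j = e (j ∸ 1)

  enumeration : IsIncEnum SU e
  enumeration = e-inc , (λ k → mayBeOne→SU (e k) (e-true k)) , (λ n n∈SU → e-surjective n (SU→mayBeOne n n∈SU))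

  fixedZero : ∀ t → tree t → (i : Fin (length t)) → f (toℕ i) ≡ fixed false → lookup t i ≡ false
  fixedZero t t∈p i fi≡0 = sym (fixed-match fi≡0 (fits-lookup f t t∈p i))

  squeeze : ∀ c i → c < i → i < 2 + c → i ≡ 1 + c
  squeeze c i c<i i<2+c = ≤-antisym (≤-pred i<2+c) c<i

  -- a window at the b-th element of the enumeration (0-indexed, b + 1 even) is a good
  -- triple at the 1-indexed position b + 1: its free coordinates are consecutive in
  -- S(p) ∪ U(p) and the coordinates between them are fixed to 0
  windowTriple : ∀ b c → Window f c → e b ≡ c → 2 ∣ suc b → GoodTriple tree nn (suc b)
  windowTriple b c W eb≡c 2∣1+b =
    2∣1+b , s≤s z≤n ,
    subst (SLevel tree) (sym eb≡c) (free→splitting c (free₀ W)) ,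
    subst (SLevel tree) (sym e1) (free→splitting (2 + c) (free₂ W)) ,
    subst (SLevel tree) (sym e2) (free→splitting (4 + c) (free₄ W)) ,
    subst₂ (λ u v → suc u < v) (sym eb≡c) (sym e1) ≤-refl ,
    subst₂ (λ u v → suc u < v) (sym e1) (sym e2) ≤-refl ,
    zeroBetween
    where
    e1 : e (suc b) ≡ 2 + c
    e1 = e-next b c eb≡c (cong mayBeOne (zero₁ W)) (cong mayBeOne (free₂ W))
    e2 : e (suc (suc b)) ≡ 4 + c
    e2 = e-next (suc b) (2 + c) e1 (cong mayBeOne (zero₃ W)) (cong mayBeOne (free₄ W))
    zeroBetween : ∀ t → tree t → ∀ (i : Fin (length t)) →
      ((e b < toℕ i × toℕ i < e (suc b)) ⊎ (e (suc b) < toℕ i × toℕ i < e (suc (suc b)))) →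
      lookup t i ≡ false
    zeroBetween t t∈p i (inj₁ (l , r)) = fixedZero t t∈p i
      (trans (cong f (squeeze c (toℕ i) (subst (_< toℕ i) eb≡c l) (subst (toℕ i <_) e1 r))) (zero₁ W))
    zeroBetween t t∈p i (inj₂ (l , r)) = fixedZero t t∈p i
      (trans (cong f (squeeze (2 + c) (toℕ i) (subst (_< toℕ i) e1 l) (subst (toℕ i <_) e2 r))) (zero₃ W))

  -- beyond any index K, take a gadget past e K; one of its two windows starts at an
  -- even 1-indexed position
  goodTriples : ∀ K → ∃[ m ] (K ≤ m × GoodTriple tree nn m)
  goodTriples K with gadgets (suc (e K))
  ... | a , eK<a , (W , W′) with e-surjective a (cong mayBeOne (free₀ W))
  ...   | j , ej≡a with e-reflects-< K j (subst (e K <_) (sym ej≡a) eK<a) | even-or-next-even (suc j)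
  ...     | K<j | inj₁ 2∣1+j = suc j , ≤-trans (<⇒≤ K<j) (n≤1+n j) , windowTriple j a W ej≡a 2∣1+j
  ...     | K<j | inj₂ 2∣2+j = suc (suc j) , ≤-trans (<⇒≤ K<j) (≤-trans (n≤1+n j) (n≤1+n (suc j))) ,
      windowTriple (suc j) (2 + a) W′ (e-next j a ej≡a (cong mayBeOne (zero₁ W)) (cong mayBeOne (free₂ W))) 2∣2+j

  mathiasSilver : MathiasSilver tree
  mathiasSilver = silver freeAbove , e , enumeration , goodTriples

-- Given for every string σ an extension dk σ, a single string T
-- is built such that for every σ of length L some initial segment τ₁ of T is followed
-- in T by dk (σ ⌢ τ₁): the strings of length L are handled one after the other, each
-- by appending its extension. The accumulator h rebuilds σ from its remaining bits.

extendAll : (List Bool → List Bool) → ℕ → (List Bool → List Bool) → List Bool → List Bool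
extendAll dk zero    h τ = τ ++ dk (h [] ++ τ)
extendAll dk (suc L) h τ = extendAll dk L (λ σ → h (true ∷ σ)) (extendAll dk L (λ σ → h (false ∷ σ)) τ)

extendAll-extends : ∀ dk L h τ → ∃[ r ] extendAll dk L h τ ≡ τ ++ r
extendAll-extends dk zero    h τ = _ , refl
extendAll-extends dk (suc L) h τ with extendAll-extends dk L (λ σ → h (false ∷ σ)) τ
... | r₀ , eq₀ with extendAll-extends dk L (λ σ → h (true ∷ σ)) (extendAll dk L (λ σ → h (false ∷ σ)) τ)
... | r₁ , eq₁ = r₀ ++ r₁ , trans eq₁ (trans (cong (_++ r₁) eq₀) (++-assoc τ r₀ r₁))

Hits : (List Bool → List Bool) → List Bool → List Bool → Set
Hits dk σ T = ∃[ τ₁ ] ∃[ r ] (T ≡ τ₁ ++ (dk (σ ++ τ₁) ++ r))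

hits-extend : ∀ {dk σ T} r → Hits dk σ T → Hits dk σ (T ++ r)
hits-extend {dk} {σ} r (τ₁ , r₁ , refl) =
  τ₁ , r₁ ++ r , trans (++-assoc τ₁ _ r) (cong (τ₁ ++_) (++-assoc (dk (σ ++ τ₁)) r₁ r))

extendAll-hits : ∀ dk σ h τ → Hits dk (h σ) (extendAll dk (length σ) h τ)
extendAll-hits dk []          h τ = τ , [] , cong (τ ++_) (sym (++-identityʳ _))
extendAll-hits dk (true ∷ σ)  h τ = extendAll-hits dk σ (λ σ′ → h (true ∷ σ′)) _
extendAll-hits dk (false ∷ σ) h τ
  with extendAll-extends dk (length σ) (λ σ′ → h (true ∷ σ′)) (extendAll dk (length σ) (λ σ′ → h (false ∷ σ′)) τ)
... | r , eq = subst (Hits dk (h (false ∷ σ))) (sym eq)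
                 (hits-extend {dk} {h (false ∷ σ)} r (extendAll-hits dk σ (λ σ′ → h (false ∷ σ′)) τ))

hits→cylinder : ∀ {dk σ T} x n → x ↾ n ≡ σ ++ T → Hits dk σ T → ∃[ u ] InCyl (u ++ dk u) x
hits→cylinder {dk} {σ} x n x↾n≡σT (τ₁ , r , refl) =
  σ ++ τ₁ , ↾-prefix x n ((σ ++ τ₁) ++ dk (σ ++ τ₁)) r (begin
    x ↾ n                                 ≡⟨ x↾n≡σT ⟩
    σ ++ (τ₁ ++ (dk (σ ++ τ₁) ++ r))      ≡⟨ sym (++-assoc σ τ₁ _) ⟩
    (σ ++ τ₁) ++ (dk (σ ++ τ₁) ++ r)      ≡⟨ sym (++-assoc (σ ++ τ₁) (dk (σ ++ τ₁)) r) ⟩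
    ((σ ++ τ₁) ++ dk (σ ++ τ₁)) ++ r      ∎)
  where open ≡-Reasoning

diagonalBlock : (List Bool → List Bool) → ℕ → List Bool
diagonalBlock dk L = extendAll dk L id []

diagonalBlock-hits : ∀ dk σ → Hits dk σ (diagonalBlock dk (length σ))
diagonalBlock-hits dk σ = extendAll-hits dk σ id []

gadget : List Code
gadget = free ∷ fixed false ∷ free ∷ fixed false ∷ free ∷ fixed false ∷ free ∷ []

gadget-windows : ∀ f a → (∀ j → j < 7 → f (j + a) ≡ entry free gadget j) → GadgetAt f a
gadget-windows f a h =
  record { free₀ = at 0 _ ; zero₁ = at 1 _ ; free₂ = at 2 _ ; zero₃ = at 3 _ ; free₄ = at 4 _ } ,
  record { free₀ = at 2 _ ; zero₁ = at 3 _ ; free₂ = at 4 _ ; zero₃ = at 5 _ ; free₄ = at 6 _ }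
  where
  at : ∀ j → T (j <ᵇ 7) → f (j + a) ≡ entry free gadget j
  at j j<7 = h j (<ᵇ⇒< j 7 j<7)

block : (List Bool → List Bool) → List Code → List Bool
block dk c = diagonalBlock dk (length c)

step : (List Bool → List Bool) → List Code → List Code
step dk c = c ++ (map fixed (block dk c) ++ gadget)

length-step : ∀ dk c → length (step dk c) ≡ length c + (length (block dk c) + 7)
length-step dk c = trans (length-++ c)
  (cong (length c +_) (trans (length-++ (map fixed (block dk c))) (cong (_+ 7) (length-map fixed (block dk c)))))

module Fusion (d : ℕ → List Bool → List Bool) (s : List Bool) where

  stage : ℕ → List Code
  stage zero    = map fixed s
  stage (suc k) = step (d k) (stage k)

  -- the limit pattern: coordinate i is settled by stage i + 1
  f : ℕ → Code
  f i = entry free (stage (suc i)) i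

  blockStart : ℕ → ℕ
  blockStart k = length (stage k)

  τ : ℕ → List Bool
  τ k = block (d k) (stage k)

  gadgetStart : ℕ → ℕ
  gadgetStart k = blockStart k + length (map fixed (τ k))

  stage-extends : ∀ {k n} → k ≤ n → ∃[ r ] stage n ≡ stage k ++ r
  stage-extends {k} {zero}  z≤n  = [] , sym (++-identityʳ _)
  stage-extends {k} {suc n} k≤n′ with m≤n⇒m<n∨m≡n k≤n′
  ... | inj₂ refl      = [] , sym (++-identityʳ _)
  ... | inj₁ (s≤s k≤n) with stage-extends k≤n
  ...   | r , eq = r ++ X , trans (cong (_++ X) eq) (++-assoc (stage k) r X)
    where
    X = map fixed (τ n) ++ gadget

  stage-length : ∀ k → k ≤ length (stage k)
  stage-length zero    = z≤n
  stage-length (suc k) = subst (suc k ≤_) (sym (length-step (d k) (stage k)))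
    (≤-trans (s≤s (stage-length k))
      (subst (_≤ length (stage k) + (length (τ k) + 7)) (+-comm (length (stage k)) 1)
        (+-monoʳ-≤ (length (stage k)) (≤-trans (s≤s z≤n) (m≤n+m 7 (length (τ k)))))))

  f-agrees : ∀ k i → i < length (stage k) → f i ≡ entry free (stage k) i
  f-agrees k i i<k with ≤-total k (suc i)
  ... | inj₁ k≤1+i with stage-extends k≤1+i
  ...   | r , eq = trans (cong (λ c → entry free c i) eq) (entry-++ˡ free (stage k) r i i<k)
  f-agrees k i i<k | inj₂ 1+i≤k with stage-extends 1+i≤k
  ...   | r , eq = sym (trans (cong (λ c → entry free c i) eq) (entry-++ˡ free (stage (suc i)) r i (stage-length (suc i))))

  f-initial : ∀ j → j < length s → f j ≡ fixed (entry false s j)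
  f-initial j j<s = trans (f-agrees 0 j (subst (j <_) (sym (length-map fixed s)) j<s)) (entry-map fixed false free s j j<s)

  f-block : ∀ k j → j < length (τ k) → f (blockStart k + j) ≡ fixed (entry false (τ k) j)
  f-block k j j<τ = trans (f-agrees (suc k) (blockStart k + j) bound)
    (trans (entry-++ʳ free (stage k) _ j)
      (trans (entry-++ˡ free (map fixed (τ k)) gadget j (subst (j <_) (sym (length-map fixed (τ k))) j<τ))
        (entry-map fixed false free (τ k) j j<τ)))
    where
    bound : blockStart k + j < length (stage (suc k))
    bound = subst (blockStart k + j <_) (sym (length-step (d k) (stage k)))
              (+-monoʳ-< (blockStart k) (≤-trans j<τ (m≤m+n (length (τ k)) 7)))

  f-gadget : ∀ k j → j < 7 → f (j + gadgetStart k) ≡ entry free gadget j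
  f-gadget k j j<7 = trans (f-agrees (suc k) (j + gadgetStart k) bound)
    (trans (cong (entry free (stage (suc k))) position)
      (trans (entry-++ʳ free (stage k) _ (lM + j)) (entry-++ʳ free (map fixed (τ k)) gadget j)))
    where
    L = blockStart k
    lM = length (map fixed (τ k))
    position : j + (L + lM) ≡ L + (lM + j)
    position = trans (+-comm j (L + lM)) (+-assoc L lM j)
    bound : j + gadgetStart k < length (stage (suc k))
    bound = subst₂ _<_ (sym position)
              (trans (cong (λ m → L + (m + 7)) (length-map fixed (τ k))) (sym (length-step (d k) (stage k))))
              (+-monoʳ-< L (+-monoʳ-< lM j<7))

  gadgets : ∀ n → ∃[ a ] (n ≤ a × GadgetAt f a)
  gadgets n = gadgetStart n , ≤-trans (stage-length n) (m≤m+n (blockStart n) _) ,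
              gadget-windows f (gadgetStart n) (f-gadget n)

  MatchAll : Cantor → Set
  MatchAll x = ∀ i → Match (f i) (x i)

  inCylinder : ∀ x → MatchAll x → InCyl s x
  inCylinder x mx = ↾-entrywise s x (λ j j<s → fixed-match (f-initial j j<s) (mx j))

  copies-block : ∀ x → MatchAll x → ∀ k → x ↾ (blockStart k + length (τ k)) ≡ (x ↾ blockStart k) ++ τ k
  copies-block x mx k = trans (↾-+ x (blockStart k) (length (τ k)))
    (cong ((x ↾ blockStart k) ++_)
      (↾-entrywise (τ k) (shift (blockStart k) x) (λ j j<τ → fixed-match (f-block k j j<τ) (mx (blockStart k + j)))))

  passes : ∀ x → MatchAll x → ∀ k → ∃[ u ] InCyl (u ++ d k u) x
  passes x mx k = hits→cylinder x _ (copies-block x mx k)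
    (subst (λ n → Hits (d k) (x ↾ blockStart k) (diagonalBlock (d k) n)) (↾-length x (blockStart k))
      (diagonalBlock-hits (d k) (x ↾ blockStart k)))

fusion : (N : ℕ → Cantor → Set) → (∀ k → NowhereDense (N k)) → (s : List Bool) →
  Σ Tree λ p → MathiasSilver p × (∀ x → Body p x → InCyl s x × (∀ k → ¬ N k x))
fusion N nowhereDense s = tree , mathiasSilver , λ x x∈p →
    inCylinder x (matching x x∈p) ,
    λ k x∈Nk → let (u , x∈[u⌢dku]) = passes x (matching x x∈p) k in proj₂ (nowhereDense k u) x x∈[u⌢dku] x∈Nk
  where
  open Fusion (λ k u → proj₁ (nowhereDense k u)) s
  open PatternTree f using (tree)
  open GadgetPattern f gadgets
  matching : ∀ x → Body tree x → MatchAll x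
  matching = prefixes→matching f

cylinderInside : ∀ {U} → IsOpen U → ∀ x₀ → U x₀ → ∃[ s ] (∀ y → InCyl s y → U y)
cylinderInside {U} U-open x₀ x₀∈U = x₀ ↾ n , λ y y∈[s] → nbhd y (subst (λ m → y ↾ m ≡ x₀ ↾ n) (↾-length x₀ n) y∈[s])
  where
  n = proj₁ (U-open x₀ x₀∈U)
  nbhd = proj₂ (U-open x₀ x₀∈U)

module OffMeager {A U : Cantor → Set} (N : ℕ → Cantor → Set) (cover : ∀ x → SymDiff A U x → ∃[ k ] N k x)
                 (x : Cantor) (generic : ∀ k → ¬ N k x) where

  U→A : ExcludedMiddle 0ℓ → U x → A x
  U→A lem x∈U with lem {A x}
  ... | yes x∈A = x∈A
  ... | no  x∉A = let (k , x∈Nk) = cover x (inj₂ (x∈U , x∉A)) in ⊥-elim (generic k x∈Nk)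

  ¬U→¬A : ¬ U x → ¬ A x
  ¬U→¬A x∉U x∈A = let (k , x∈Nk) = cover x (inj₁ (x∈A , x∉U)) in generic k x∈Nk

mainTheorem3 : ExcludedMiddle 0ℓ → (A : Cantor → Set) → BaireProperty A →
    Σ Tree λ p → (MathiasSilver p × ((∀ x → Body p x → A x) ⊎ (∀ x → Body p x → ¬ A x)))
mainTheorem3 lem A (U , U-open , N , nowhereDense , cover) with lem {Σ Cantor U}
... | yes (x₀ , x₀∈U) =
  let (s , [s]⊆U) = cylinderInside U-open x₀ x₀∈U
      (p , p-MS , inside) = fusion N nowhereDense s
  in p , p-MS , inj₁ λ x x∈p →
       let (x∈[s] , generic) = inside x x∈p in OffMeager.U→A N cover x generic lem ([s]⊆U x x∈[s])
... | no U-empty =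
  let (p , p-MS , inside) = fusion N nowhereDense []
  in p , p-MS , inj₂ λ x x∈p → OffMeager.¬U→¬A N cover x (proj₂ (inside x x∈p)) (λ x∈U → U-empty (x , x∈U))
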